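{- For every non-negative integer $m$, \[ \sum_{n=1}^\infty \frac{n}{5^{n+1}}\binom{2n+1}{m}=\frac{(5m+1)F_{m+1}+(5m-3)F_m}{2^{m+4}}, \qquad \sum_{n=1}^\infty \frac{n}{5^{n+1}}\binom{2n}{m}=\frac{(3m+1)F_{m+1}+(m+1)F_m}{2^{m+4}}. \]
   Context: $F_n$ denotes the $n$-th Fibonacci number ($F_0=0$, $F_1=1$, $F_n=F_{n-1}+F_{n-2}$). Binomial coefficients $\binom{N}{m}$ vanish when $m>N$. -}

module Defs where

open import Data.Nat as ℕ using (ℕ; zero; suc; _≤_)
open import Data.Nat.Properties using (m^n≢0)
open import Data.Nat.Combinatorics using (_C_)
open import Data.Integer as ℤ using (ℤ; +_)
open import Data.Rational as ℚ using (ℚ; 0ℚ; _/_; ∣_∣)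
open import Data.Product using (∃-syntax)

F : ℕ → ℕ
F zero = 0
F (suc zero) = 1
F (suc (suc n)) = F (suc n) ℕ.+ F n

_over5^_ : ℕ → ℕ → ℚ
k over5^ e = (+ k) / (5 ℕ.^ e) where instance _ = m^n≢0 5 e

Σ₁ : ℕ → (ℕ → ℚ) → ℚ
Σ₁ zero f = 0ℚ
Σ₁ (suc K) f = Σ₁ K f ℚ.+ f (suc K)

-- an infinite series with partial sums s K converges (in ℚ, hence in ℝ) to L
ConvergesTo : (ℕ → ℚ) → ℚ → Set
ConvergesTo s L = ∀ (ε : ℚ) → 0ℚ ℚ.< ε →
  ∃[ N ] (∀ K → N ≤ K → ∣ s K ℚ.- L ∣ ℚ.< ε)

S-odd : ℕ → ℕ → ℚ
S-odd m K = Σ₁ K (λ n → (n ℕ.* ((2 ℕ.* n ℕ.+ 1) C m)) over5^ (n ℕ.+ 1))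

S-even : ℕ → ℕ → ℚ
S-even m K = Σ₁ K (λ n → (n ℕ.* ((2 ℕ.* n) C m)) over5^ (n ℕ.+ 1))

-- ((5m+1) F_{m+1} + (5m-3) F_m) / 2^{m+4}   (integer numerator: 5m-3 may be negative)
RHS-odd : ℕ → ℚ
RHS-odd m = ((+ (5 ℕ.* m ℕ.+ 1)) ℤ.* (+ F (suc m)) ℤ.+ ((+ (5 ℕ.* m)) ℤ.- (+ 3)) ℤ.* (+ F m))
            / (2 ℕ.^ (m ℕ.+ 4))
  where instance _ = m^n≢0 2 (m ℕ.+ 4)

RHS-even : ℕ → ℚ
RHS-even m = (+ ((3 ℕ.* m ℕ.+ 1) ℕ.* F (suc m) ℕ.+ (m ℕ.+ 1) ℕ.* F m))
             / (2 ℕ.^ (m ℕ.+ 4))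
  where instance _ = m^n≢0 2 (m ℕ.+ 4)

module Submission where

-- Write μ m = Σ_{n ≥ 1} C(2n,m)/5^{n+1} and ν m = Σ_{n ≥ 1} n C(2n,m)/5^{n+1}.  Applying Pascal's rule
-- twice, C(2n+2,m) = C(2n,m) + 2 C(2n,m-1) + C(2n,m-2), and shifting the index of summation gives
-- 4 μ m = C(2,m)/5 + 2 μ (m-1) + μ (m-2).  The weights n C(2n,m) satisfy the same recurrence up to the
-- extra term C(2n+2,m), whence 4 ν m = 5 μ m + 2 ν (m-1) + ν (m-2).  The Fibonacci recurrence shows
-- that μ m = F_{m+1}/2^{m+2} (m ≥ 1) and the even right-hand side ν m solve these recurrences, and
-- C(2n+1,m) = C(2n,m) + C(2n,m-1) reduces the odd series to two even ones.
-- All of this is carried out for the tails after K terms, where the same linear relations hold up to a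
-- leading term of size at most (4/5)^{K+1}.  Induction on m then bounds the tails by (4/5)^{K+1} and
-- (K+5)(4/5)^{K+1}, and since (K+1)(K+5)(4/5)^{K+1} ≤ 36 the partial sums converge at rate 1/K.

open import Defs
open import Data.Nat using (ℕ)
open import Data.Product using (_×_)

open import Data.Product using (_,_; proj₁; proj₂; ∃-syntax)
open import Data.Nat as ℕ using (zero; suc; z≤n)
import Data.Nat.Properties as ℕₚ
import Data.Nat.Tactic.RingSolver as ℕ-Solver
open import Data.Nat.Combinatorics using (_C_; nCk+nC[k+1]≡[n+1]C[k+1])
open import Data.Integer as ℤ using (ℤ; +_; -[1+_])
import Data.Integer.Properties as ℤₚ
import Data.Rational as ℚ
open ℚ
  using (ℚ; mkℚ; toℚᵘ; 0ℚ; 1ℚ; ½; _+_; _*_; _-_; -_; _/_; _≤_; _<_; ∣_∣; *≤*; *<*)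
import Data.Rational.Properties as ℚₚ
import Data.Rational.Unnormalised as ℚᵘ
open import Agda.Builtin.FromNat using (Number; fromNat)
open import Data.Unit using (⊤; tt)
import Data.Nat.Literals as ℕ-Literals
open import Data.Rational.Literals using (number; fromℤ)
open import Algebra.Bundles using (CommutativeRing)
open import Algebra.Properties.CommutativeSemiring.Exp
  (CommutativeRing.commutativeSemiring ℚₚ.+-*-commutativeRing)
  using (_^_; ^-distrib-*)
open import Relation.Nullary.Decidable using (dec⇒maybe)
open import Level using (0ℓ)
open import Tactic.RingSolver using (solve-∀)
open import Tactic.RingSolver.Core.AlmostCommutativeRing
  using (AlmostCommutativeRing; fromCommutativeRing)
open import Relation.Binary.PropositionalEquality
open import Function using (_∘_)

-- The ⊤ instance discharges the trivial constraint of the ℚ literal instance.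
instance
  ℕ-number : Number ℕ
  ℕ-number = ℕ-Literals.number
  ℚ-number : Number ℚ
  ℚ-number = number
  ⊤-instance : ⊤
  ⊤-instance = tt

ℚ-ring : AlmostCommutativeRing 0ℓ 0ℓ
ℚ-ring = fromCommutativeRing ℚₚ.+-*-commutativeRing (λ x → dec⇒maybe (0ℚ ℚₚ.≟ x))

fromℕ : ℕ → ℚ
fromℕ n = fromℤ (+ n)

fromℤ-+ : ∀ i j → fromℤ (i ℤ.+ j) ≡ fromℤ i + fromℤ j
fromℤ-+ i j = trans (sym (ℚₚ.↥p/↧p≡p (fromℤ (i ℤ.+ j))))
  (ℚₚ./-cong (cong₂ ℤ._+_ (sym (ℤₚ.*-identityʳ i)) (sym (ℤₚ.*-identityʳ j))) refl)

fromℤ-* : ∀ i j → fromℤ (i ℤ.* j) ≡ fromℤ i * fromℤ j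
fromℤ-* i j = sym (ℚₚ.↥p/↧p≡p (fromℤ (i ℤ.* j)))

fromℕ-+ : ∀ m n → fromℕ (m ℕ.+ n) ≡ fromℕ m + fromℕ n
fromℕ-+ m n = trans (cong fromℤ (ℤₚ.pos-+ m n)) (fromℤ-+ (+ m) (+ n))

fromℕ-* : ∀ m n → fromℕ (m ℕ.* n) ≡ fromℕ m * fromℕ n
fromℕ-* m n = trans (cong fromℤ (ℤₚ.pos-* m n)) (fromℤ-* (+ m) (+ n))

fromℕ-^ : ∀ m n → fromℕ (m ℕ.^ n) ≡ fromℕ m ^ n
fromℕ-^ m zero    = refl
fromℕ-^ m (suc n) = trans (fromℕ-* m (m ℕ.^ n)) (cong (fromℕ m *_) (fromℕ-^ m n))

fromℕ-mono-≤ : ∀ {m n} → m ℕ.≤ n → fromℕ m ≤ fromℕ n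
fromℕ-mono-≤ m≤n = *≤* (ℤₚ.*-monoʳ-≤-nonNeg (+ 1) (ℤ.+≤+ m≤n))

fromℕ-mono-< : ∀ {m n} → m ℕ.< n → fromℕ m < fromℕ n
fromℕ-mono-< m<n = *<* (ℤₚ.*-monoʳ-<-pos (+ 1) (ℤ.+<+ m<n))

0≤fromℕ : ∀ n → 0ℚ ≤ fromℕ n
0≤fromℕ n = fromℕ-mono-≤ z≤n

/-*-/ : ∀ i j a b .{{_ : ℕ.NonZero a}} .{{_ : ℕ.NonZero b}} →
        (i / a) * (j / b) ≡ ((i ℤ.* j) / (a ℕ.* b)) {{ℕₚ.m*n≢0 a b}}
/-*-/ i j (suc a) (suc b) = ℚₚ.toℚᵘ-injective (begin
  toℚᵘ (i / suc a * (j / suc b))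
    ≈⟨ ℚₚ.toℚᵘ-homo-* (i / suc a) (j / suc b) ⟩
  toℚᵘ (i / suc a) ℚᵘ.* toℚᵘ (j / suc b)
    ≈⟨ ℚᵘₚ.*-cong (ℚₚ.toℚᵘ-fromℚᵘ (ℚᵘ.mkℚᵘ i a)) (ℚₚ.toℚᵘ-fromℚᵘ (ℚᵘ.mkℚᵘ j b)) ⟩
  ℚᵘ.mkℚᵘ i a ℚᵘ.* ℚᵘ.mkℚᵘ j b
    ≈⟨ ℚᵘₚ.≃-sym (ℚₚ.toℚᵘ-fromℚᵘ (ℚᵘ.mkℚᵘ i a ℚᵘ.* ℚᵘ.mkℚᵘ j b)) ⟩
  toℚᵘ ((i ℤ.* j) / (suc a ℕ.* suc b)) ∎)
  where
  import Data.Rational.Unnormalised.Properties as ℚᵘₚ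
  open ℚᵘₚ.≃-Reasoning

/-^ : ∀ i a e → (i / (suc a ℕ.^ e)) {{ℕₚ.m^n≢0 (suc a) e}} ≡ fromℤ i * (+ 1 / suc a) ^ e
/-^ i a zero    = trans (ℚₚ.↥p/↧p≡p (fromℤ i)) (sym (ℚₚ.*-identityʳ (fromℤ i)))
/-^ i a (suc e) = begin
  (i / (suc a ℕ.* suc a ℕ.^ e)) {{nz (suc e)}}
    ≡⟨ ℚₚ./-cong {{nz (suc e)}} {{nz (suc e)}} (sym (ℤₚ.*-identityˡ i)) refl ⟩
  ((+ 1 ℤ.* i) / (suc a ℕ.* suc a ℕ.^ e)) {{nz (suc e)}}
    ≡⟨ sym (/-*-/ (+ 1) i (suc a) (suc a ℕ.^ e) {{_}} {{nz e}}) ⟩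
  (+ 1 / suc a) * (i / suc a ℕ.^ e) {{nz e}}
    ≡⟨ cong ((+ 1 / suc a) *_) (/-^ i a e) ⟩
  (+ 1 / suc a) * (fromℤ i * (+ 1 / suc a) ^ e)
    ≡⟨ swap (+ 1 / suc a) (fromℤ i) ((+ 1 / suc a) ^ e) ⟩
  fromℤ i * (+ 1 / suc a) ^ suc e ∎
  where
  open ≡-Reasoning
  nz : ∀ e → ℕ.NonZero (suc a ℕ.^ e)
  nz e = ℕₚ.m^n≢0 (suc a) e
  swap : ∀ x y z → x * (y * z) ≡ y * (x * z)
  swap = solve-∀ ℚ-ring

infix 4 _∈[0,_]

_∈[0,_] : ℚ → ℚ → Set
x ∈[0, B ] = 0ℚ ≤ x × x ≤ B

*-nonNeg : ∀ {x y} → 0ℚ ≤ x → 0ℚ ≤ y → 0ℚ ≤ x * y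
*-nonNeg {x} {y} 0≤x 0≤y =
  ℚₚ.nonNegative⁻¹ (x * y) {{ℚₚ.nonNeg*nonNeg⇒nonNeg x {{ℚ.nonNegative 0≤x}} y {{ℚ.nonNegative 0≤y}}}}

^-nonNeg : ∀ {x} n → 0ℚ ≤ x → 0ℚ ≤ x ^ n
^-nonNeg zero    0≤x = *≤* (ℤ.+≤+ z≤n)
^-nonNeg (suc n) 0≤x = *-nonNeg 0≤x (^-nonNeg n 0≤x)

*-monoˡ-≤ : ∀ {c x y} → 0ℚ ≤ c → x ≤ y → c * x ≤ c * y
*-monoˡ-≤ {c} 0≤c = ℚₚ.*-monoˡ-≤-nonNeg c {{ℚ.nonNegative 0≤c}}

∈-+ : ∀ {x y A B} → x ∈[0, A ] → y ∈[0, B ] → x + y ∈[0, A + B ]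
∈-+ (0≤x , x≤A) (0≤y , y≤B) = ℚₚ.+-mono-≤ 0≤x 0≤y , ℚₚ.+-mono-≤ x≤A y≤B

∈-* : ∀ {c x B} → 0ℚ ≤ c → x ∈[0, B ] → c * x ∈[0, c * B ]
∈-* 0≤c (0≤x , x≤B) = *-nonNeg 0≤c 0≤x , *-monoˡ-≤ 0≤c x≤B

mean-bound : ∀ {f t g h B} → 4 * f ≡ t + 2 * g + h →
             t ∈[0, B ] → g ∈[0, B ] → h ∈[0, B ] → f ∈[0, B ]
mean-bound {f} {t} {g} {h} {B} eq t∈ g∈ h∈ =
  ℚₚ.*-cancelˡ-≤-pos 4 (proj₁ 4f∈) , ℚₚ.*-cancelˡ-≤-pos 4 (subst (4 * f ≤_) (sum≡4* B) (proj₂ 4f∈))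
  where
  4f∈ : 4 * f ∈[0, B + 2 * B + B ]
  4f∈ = subst (_∈[0, B + 2 * B + B ]) (sym eq) (∈-+ (∈-+ t∈ (∈-* (0≤fromℕ 2) g∈)) h∈)
  sum≡4* : ∀ B → B + 2 * B + B ≡ 4 * B
  sum≡4* = solve-∀ ℚ-ring

⅕ : ℚ
⅕ = + 1 / 5

zeros : ℕ → ℚ
zeros _ = 0ℚ

weight : (ℕ → ℚ) → ℕ → ℚ
weight c n = fromℕ n * c n

weight-zeros : ∀ n → weight zeros n ≡ 0ℚ
weight-zeros n = ℚₚ.*-zeroʳ (fromℕ n)

S₀ S₁ : (ℕ → ℚ) → ℕ → ℚ
S₀ c K = Σ₁ K (λ n → c n * ⅕ ^ suc n)
S₁ c = S₀ (weight c)

Σ₁-cong : ∀ {f g} → (∀ n → f n ≡ g n) → ∀ K → Σ₁ K f ≡ Σ₁ K g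
Σ₁-cong f≡g zero    = refl
Σ₁-cong f≡g (suc K) = cong₂ _+_ (Σ₁-cong f≡g K) (f≡g (suc K))

Σ₁-+ : ∀ f g K → Σ₁ K (λ n → f n + g n) ≡ Σ₁ K f + Σ₁ K g
Σ₁-+ f g zero    = refl
Σ₁-+ f g (suc K) = trans (cong (_+ (f (suc K) + g (suc K))) (Σ₁-+ f g K))
                         (interchange (Σ₁ K f) (Σ₁ K g) (f (suc K)) (g (suc K)))
  where
  interchange : ∀ a b c d → a + b + (c + d) ≡ a + c + (b + d)
  interchange = solve-∀ ℚ-ring

S₀-zero : ∀ {c} → (∀ n → c n ≡ 0ℚ) → ∀ K → S₀ c K ≡ 0ℚ
S₀-zero c≡0 zero    = refl
S₀-zero {c} c≡0 (suc K) = begin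
  S₀ c K + c (suc K) * y  ≡⟨ cong₂ (λ s a → s + a * y) (S₀-zero c≡0 K) (c≡0 (suc K)) ⟩
  0ℚ + 0ℚ * y             ≡⟨ trans (ℚₚ.+-identityˡ (0ℚ * y)) (ℚₚ.*-zeroˡ y) ⟩
  0ℚ                      ∎
  where
  open ≡-Reasoning
  y : ℚ
  y = ⅕ ^ suc (suc K)

S₀-shift : ∀ c K → S₀ c (suc K) ≡ c 1 * ⅕ ^ 2 + ⅕ * S₀ (c ∘ suc) K
S₀-shift c zero    = move (c 1 * ⅕ ^ 2)
  where
  move : ∀ a → 0ℚ + a ≡ a + ⅕ * 0ℚ
  move = solve-∀ ℚ-ring
S₀-shift c (suc K) = begin
  S₀ c (suc K) + c (suc (suc K)) * (⅕ * y)         ≡⟨ cong (_+ c (suc (suc K)) * (⅕ * y)) (S₀-shift c K) ⟩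
  c 1 * ⅕ ^ 2 + ⅕ * S + c (suc (suc K)) * (⅕ * y)  ≡⟨ factor (c 1 * ⅕ ^ 2) S (c (suc (suc K))) y ⟩
  c 1 * ⅕ ^ 2 + ⅕ * (S + c (suc (suc K)) * y)      ∎
  where
  open ≡-Reasoning
  y S : ℚ
  y = ⅕ ^ suc (suc K)
  S = S₀ (c ∘ suc) K
  factor : ∀ u S a y → u + ⅕ * S + a * (⅕ * y) ≡ u + ⅕ * (S + a * y)
  factor = solve-∀ ℚ-ring

-- Tails of series with a Pascal-type recurrence

record PascalStep (c c′ c″ e : ℕ → ℚ) : Set where
  constructor pascal-step
  field
    step : ∀ n → c (suc n) ≡ c n + 2 * c′ n + c″ n + e n

-- For M, M′, M″, E the sums of S₀ c, S₀ c′, S₀ c″, S₀ e, base is the index shift n ↦ n + 1 in S₀ c,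
-- and the same relation then holds between the tails after K terms.
module _ {c c′ c″ e : ℕ → ℚ} (pascal : PascalStep c c′ c″ e) (M M′ M″ E : ℚ)
         (base : 4 * M ≡ ⅕ * c 1 + E + 2 * M′ + M″) where

  open PascalStep pascal

  tail-identity : ∀ K →
    4 * (M - S₀ c K) ≡ ⅕ ^ suc K * c (suc K) + (E - S₀ e K) + 2 * (M′ - S₀ c′ K) + (M″ - S₀ c″ K)
  tail-identity zero = begin
    4 * (M - 0ℚ)                                         ≡⟨ cong (4 *_) (ℚₚ.+-identityʳ M) ⟩
    4 * M                                                ≡⟨ base ⟩
    ⅕ * c 1 + E + 2 * M′ + M″                            ≡⟨ subtract-zeros (c 1) E M′ M″ ⟩
    ⅕ ^ 1 * c 1 + (E - 0ℚ) + 2 * (M′ - 0ℚ) + (M″ - 0ℚ) ∎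
    where
    open ≡-Reasoning
    subtract-zeros : ∀ a E M′ M″ →
      ⅕ * a + E + 2 * M′ + M″ ≡ ⅕ * 1ℚ * a + (E - 0ℚ) + 2 * (M′ - 0ℚ) + (M″ - 0ℚ)
    subtract-zeros = solve-∀ ℚ-ring
  tail-identity (suc K) rewrite step (suc K) = begin
    4 * (M - S₀ c (suc K))
      ≡⟨ split-last M (S₀ c K) a x ⟩
    4 * (M - S₀ c K) - 4 * (a * x)
      ≡⟨ cong (_- 4 * (a * x)) (tail-identity K) ⟩
    y * a + (E - S₀ e K) + 2 * (M′ - S₀ c′ K) + (M″ - S₀ c″ K) - 4 * (a * x)
      ≡⟨ regroup y a a′ a″ b E (S₀ e K) M′ (S₀ c′ K) M″ (S₀ c″ K) ⟩
    x * (a + 2 * a′ + a″ + b) + (E - S₀ e (suc K)) + 2 * (M′ - S₀ c′ (suc K)) + (M″ - S₀ c″ (suc K)) ∎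
    where
    open ≡-Reasoning
    y x a a′ a″ b : ℚ
    y = ⅕ ^ suc K
    x = ⅕ * y
    a = c (suc K)
    a′ = c′ (suc K)
    a″ = c″ (suc K)
    b = e (suc K)
    split-last : ∀ M S a x → 4 * (M - (S + a * x)) ≡ 4 * (M - S) - 4 * (a * x)
    split-last = solve-∀ ℚ-ring
    regroup : ∀ y a a′ a″ b E S M′ S′ M″ S″ →
      y * a + (E - S) + 2 * (M′ - S′) + (M″ - S″) - 4 * (a * (⅕ * y))
        ≡ ⅕ * y * (a + 2 * a′ + a″ + b) + (E - (S + b * (⅕ * y)))
            + 2 * (M′ - (S′ + a′ * (⅕ * y))) + (M″ - (S″ + a″ * (⅕ * y)))
    regroup = solve-∀ ℚ-ring

zeroth-moment-identity : ∀ {c c′ c″} → PascalStep c c′ c″ zeros → ∀ M M′ M″ →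
  4 * M ≡ ⅕ * c 1 + 2 * M′ + M″ → ∀ K →
  4 * (M - S₀ c K) ≡ ⅕ ^ suc K * c (suc K) + 2 * (M′ - S₀ c′ K) + (M″ - S₀ c″ K)
zeroth-moment-identity {c} {c′} {c″} pascal M M′ M″ base K = begin
  4 * (M - S₀ c K)                         ≡⟨ tail-identity pascal M M′ M″ 0ℚ base₀ K ⟩
  lead + (0ℚ - S₀ zeros K) + 2 * T′ + T″
    ≡⟨ cong (λ s → lead + (0ℚ - s) + 2 * T′ + T″) (S₀-zero (λ _ → refl) K) ⟩
  lead + 0ℚ + 2 * T′ + T″                  ≡⟨ cong (λ z → z + 2 * T′ + T″) (ℚₚ.+-identityʳ lead) ⟩
  lead + 2 * T′ + T″                       ∎
  where
  open ≡-Reasoning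
  lead T′ T″ : ℚ
  lead = ⅕ ^ suc K * c (suc K)
  T′ = M′ - S₀ c′ K
  T″ = M″ - S₀ c″ K
  base₀ : 4 * M ≡ ⅕ * c 1 + 0ℚ + 2 * M′ + M″
  base₀ = trans base (cong (λ z → z + 2 * M′ + M″) (sym (ℚₚ.+-identityʳ (⅕ * c 1))))

weighted-step : ∀ {c c′ c″} → PascalStep c c′ c″ zeros →
  PascalStep (weight c) (weight c′) (weight c″) (c ∘ suc)
weighted-step {c} {c′} {c″} (pascal-step step) = pascal-step weighted
  where
  split : ∀ k a → (1 + k) * a ≡ k * a + a
  split = solve-∀ ℚ-ring
  distribute : ∀ k a a′ a″ b → k * (a + 2 * a′ + a″ + 0ℚ) + b ≡ k * a + 2 * (k * a′) + k * a″ + b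
  distribute = solve-∀ ℚ-ring
  weighted : ∀ n → weight c (suc n) ≡ weight c n + 2 * weight c′ n + weight c″ n + c (suc n)
  weighted n = begin
    fromℕ (suc n) * c (suc n)                   ≡⟨ cong (_* c (suc n)) (fromℕ-+ 1 n) ⟩
    (1 + k) * c (suc n)                         ≡⟨ split k (c (suc n)) ⟩
    k * c (suc n) + c (suc n)                   ≡⟨ cong (λ z → k * z + c (suc n)) (step n) ⟩
    k * (c n + 2 * c′ n + c″ n + 0ℚ) + c (suc n) ≡⟨ distribute k (c n) (c′ n) (c″ n) (c (suc n)) ⟩
    k * c n + 2 * (k * c′ n) + k * c″ n + c (suc n) ∎
    where
    open ≡-Reasoning
    k : ℚ
    k = fromℕ n

-- weight c satisfies the recurrence of c up to the extra term c (n + 1), whose series sums to 5 M - c 1 / 5.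
first-moment-identity : ∀ {c c′ c″} → PascalStep c c′ c″ zeros → ∀ M L L′ L″ →
  4 * L ≡ 5 * M + 2 * L′ + L″ → ∀ K →
  4 * (L - S₁ c K) ≡ ⅕ ^ suc K * (fromℕ (suc K) * c (suc K)) + 5 * (M - S₀ c (suc K))
                       + 2 * (L′ - S₁ c′ K) + (L″ - S₁ c″ K)
first-moment-identity {c} {c′} {c″} pascal M L L′ L″ base K = begin
  4 * (L - S₁ c K)
    ≡⟨ tail-identity (weighted-step pascal) L L′ L″ (5 * M - ⅕ * c 1) base₁ K ⟩
  lead + (5 * M - ⅕ * c 1 - S₀ (c ∘ suc) K) + 2 * T′ + T″
    ≡⟨ cong (λ z → lead + z + 2 * T′ + T″) (factor-5 M (c 1) (S₀ (c ∘ suc) K)) ⟩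
  lead + 5 * (M - (c 1 * ⅕ ^ 2 + ⅕ * S₀ (c ∘ suc) K)) + 2 * T′ + T″
    ≡⟨ cong (λ s → lead + 5 * (M - s) + 2 * T′ + T″) (sym (S₀-shift c K)) ⟩
  lead + 5 * (M - S₀ c (suc K)) + 2 * T′ + T″ ∎
  where
  open ≡-Reasoning
  lead T′ T″ : ℚ
  lead = ⅕ ^ suc K * (fromℕ (suc K) * c (suc K))
  T′ = L′ - S₁ c′ K
  T″ = L″ - S₁ c″ K
  base₁ : 4 * L ≡ ⅕ * (1 * c 1) + (5 * M - ⅕ * c 1) + 2 * L′ + L″
  base₁ = trans base (insert (c 1) M L′ L″)
    where
    insert : ∀ a M L′ L″ → 5 * M + 2 * L′ + L″ ≡ ⅕ * (1 * a) + (5 * M - ⅕ * a) + 2 * L′ + L″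
    insert = solve-∀ ℚ-ring
  factor-5 : ∀ M a S → 5 * M - ⅕ * a - S ≡ 5 * (M - (a * ⅕ ^ 2 + ⅕ * S))
  factor-5 = solve-∀ ℚ-ring

-- The coefficients C(2n, m) and the sums of the series

C-pascal² : ∀ N k → suc (suc N) C suc (suc k) ≡ N C suc (suc k) ℕ.+ 2 ℕ.* (N C suc k) ℕ.+ N C k
C-pascal² N k = begin
  suc (suc N) C suc (suc k)                            ≡⟨ sym (nCk+nC[k+1]≡[n+1]C[k+1] (suc N) (suc k)) ⟩
  suc N C suc k ℕ.+ suc N C suc (suc k)                ≡⟨ cong₂ ℕ._+_ (sym (nCk+nC[k+1]≡[n+1]C[k+1] N k))
                                                                      (sym (nCk+nC[k+1]≡[n+1]C[k+1] N (suc k))) ⟩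
  (N C k ℕ.+ N C suc k) ℕ.+ (N C suc k ℕ.+ N C suc (suc k)) ≡⟨ regroup (N C k) (N C suc k) (N C suc (suc k)) ⟩
  N C suc (suc k) ℕ.+ 2 ℕ.* (N C suc k) ℕ.+ N C k        ∎
  where
  open ≡-Reasoning
  regroup : ∀ a b c → (a ℕ.+ b) ℕ.+ (b ℕ.+ c) ≡ c ℕ.+ 2 ℕ.* b ℕ.+ a
  regroup = ℕ-Solver.solve-∀

C-pascal²-1 : ∀ N → suc (suc N) C 1 ≡ N C 1 ℕ.+ 2 ℕ.* (N C 0) ℕ.+ 0
C-pascal²-1 N = begin
  suc (suc N) C 1                 ≡⟨ sym (nCk+nC[k+1]≡[n+1]C[k+1] (suc N) 0) ⟩
  1 ℕ.+ suc N C 1                 ≡⟨ cong (1 ℕ.+_) (sym (nCk+nC[k+1]≡[n+1]C[k+1] N 0)) ⟩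
  1 ℕ.+ (1 ℕ.+ N C 1)             ≡⟨ regroup (N C 1) ⟩
  N C 1 ℕ.+ 2 ℕ.* (N C 0) ℕ.+ 0     ∎
  where
  open ≡-Reasoning
  regroup : ∀ a → 1 ℕ.+ (1 ℕ.+ a) ≡ a ℕ.+ 2 ℕ.* 1 ℕ.+ 0
  regroup = ℕ-Solver.solve-∀

C≤2^ : ∀ N k → N C k ℕ.≤ 2 ℕ.^ N
C≤2^ zero    zero    = ℕₚ.≤-refl
C≤2^ zero    (suc k) = z≤n
C≤2^ (suc N) zero    = ℕₚ.m^n>0 2 (suc N)
C≤2^ (suc N) (suc k) = begin
  suc N C suc k                 ≡⟨ sym (nCk+nC[k+1]≡[n+1]C[k+1] N k) ⟩
  N C k ℕ.+ N C suc k           ≤⟨ ℕₚ.+-mono-≤ (C≤2^ N k) (C≤2^ N (suc k)) ⟩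
  2 ℕ.^ N ℕ.+ 2 ℕ.^ N           ≡⟨ cong (2 ℕ.^ N ℕ.+_) (sym (ℕₚ.+-identityʳ (2 ℕ.^ N))) ⟩
  2 ℕ.^ suc N                   ∎
  where open ℕₚ.≤-Reasoning

C₂ : ℕ → ℕ → ℚ
C₂ m n = fromℕ ((2 ℕ.* n) C m)

fromℕ-pascal : ∀ a b c → fromℕ (a ℕ.+ 2 ℕ.* b ℕ.+ c) ≡ fromℕ a + 2 * fromℕ b + fromℕ c + 0ℚ
fromℕ-pascal a b c = begin
  fromℕ (a ℕ.+ 2 ℕ.* b ℕ.+ c)          ≡⟨ fromℕ-+ (a ℕ.+ 2 ℕ.* b) c ⟩
  fromℕ (a ℕ.+ 2 ℕ.* b) + fromℕ c
    ≡⟨ cong (_+ fromℕ c) (trans (fromℕ-+ a (2 ℕ.* b)) (cong (_+_ (fromℕ a)) (fromℕ-* 2 b))) ⟩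
  fromℕ a + 2 * fromℕ b + fromℕ c      ≡⟨ sym (ℚₚ.+-identityʳ _) ⟩
  fromℕ a + 2 * fromℕ b + fromℕ c + 0ℚ ∎
  where open ≡-Reasoning

C₂-pascal₀ : PascalStep (C₂ 0) zeros zeros zeros
C₂-pascal₀ = pascal-step λ n → refl

C₂-pascal₁ : PascalStep (C₂ 1) (C₂ 0) zeros zeros
C₂-pascal₁ = pascal-step λ n →
  trans (cong (λ N → fromℕ (N C 1)) (ℕₚ.*-suc 2 n))
        (trans (cong fromℕ (C-pascal²-1 (2 ℕ.* n))) (fromℕ-pascal ((2 ℕ.* n) C 1) ((2 ℕ.* n) C 0) 0))

C₂-pascal : ∀ m → PascalStep (C₂ (suc (suc m))) (C₂ (suc m)) (C₂ m) zeros
C₂-pascal m = pascal-step λ n →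
  trans (cong (λ N → fromℕ (N C suc (suc m))) (ℕₚ.*-suc 2 n))
        (trans (cong fromℕ (C-pascal² (2 ℕ.* n) m))
               (fromℕ-pascal ((2 ℕ.* n) C suc (suc m)) ((2 ℕ.* n) C suc m) ((2 ℕ.* n) C m)))

C₂≤4^ : ∀ m n → C₂ m n ≤ 4 ^ n
C₂≤4^ m n = begin
  C₂ m n                       ≤⟨ fromℕ-mono-≤ (C≤2^ (2 ℕ.* n) m) ⟩
  fromℕ (2 ℕ.^ (2 ℕ.* n))      ≡⟨ cong fromℕ (sym (ℕₚ.^-*-assoc 2 2 n)) ⟩
  fromℕ (4 ℕ.^ n)              ≡⟨ fromℕ-^ 4 n ⟩
  4 ^ n                        ∎
  where open ℚₚ.≤-Reasoning

r : ℚ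
r = + 4 / 5

0≤⅕ : 0ℚ ≤ ⅕
0≤⅕ = *≤* (ℤ.+≤+ z≤n)

0≤r : 0ℚ ≤ r
0≤r = *≤* (ℤ.+≤+ z≤n)

lead-bound : ∀ m n → ⅕ ^ n * C₂ m n ∈[0, r ^ n ]
lead-bound m n = *-nonNeg (^-nonNeg n 0≤⅕) (0≤fromℕ _) , (begin
  ⅕ ^ n * C₂ m n   ≤⟨ *-monoˡ-≤ (^-nonNeg n 0≤⅕) (C₂≤4^ m n) ⟩
  ⅕ ^ n * 4 ^ n    ≡⟨ sym (^-distrib-* ⅕ 4 n) ⟩
  r ^ n            ∎)
  where open ℚₚ.≤-Reasoning

-- μ m and ν m are the sums of the series S₀ (C₂ m) and S₁ (C₂ m).
μ : ℕ → ℚ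
μ zero    = + 1 / 20
μ (suc m) = fromℕ (F (suc (suc m))) * ½ ^ (3 ℕ.+ m)

R : ℕ → ℕ
R m = (3 ℕ.* m ℕ.+ 1) ℕ.* F (suc m) ℕ.+ (m ℕ.+ 1) ℕ.* F m

ν : ℕ → ℚ
ν m = fromℕ (R m) * ½ ^ (4 ℕ.+ m)

μ-rec : ∀ j → 4 * μ (3 ℕ.+ j) ≡ ⅕ * C₂ (3 ℕ.+ j) 1 + 2 * μ (2 ℕ.+ j) + μ (1 ℕ.+ j)
μ-rec j = begin
  4 * (fromℕ (F (3 ℕ.+ j) ℕ.+ F (2 ℕ.+ j)) * (½ * (½ * P)))
    ≡⟨ cong (λ f → 4 * (f * (½ * (½ * P)))) (fromℕ-+ (F (3 ℕ.+ j)) (F (2 ℕ.+ j))) ⟩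
  4 * ((a + b) * (½ * (½ * P)))
    ≡⟨ regroup a b P ⟩
  ⅕ * 0ℚ + 2 * (a * (½ * P)) + b * P ∎
  where
  open ≡-Reasoning
  a b P : ℚ
  a = fromℕ (F (3 ℕ.+ j))
  b = fromℕ (F (2 ℕ.+ j))
  P = ½ ^ (3 ℕ.+ j)
  regroup : ∀ a b P → 4 * ((a + b) * (½ * (½ * P))) ≡ ⅕ * 0ℚ + 2 * (a * (½ * P)) + b * P
  regroup = solve-∀ ℚ-ring

R-rec : ∀ j → R (2 ℕ.+ j) ≡ 5 ℕ.* F (3 ℕ.+ j) ℕ.+ R (1 ℕ.+ j) ℕ.+ R j
R-rec j = fib-identity j (F (suc j)) (F j)
  where
  fib-identity : ∀ j a b →
    (3 ℕ.* (2 ℕ.+ j) ℕ.+ 1) ℕ.* ((a ℕ.+ b) ℕ.+ a) ℕ.+ (2 ℕ.+ j ℕ.+ 1) ℕ.* (a ℕ.+ b)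
      ≡ 5 ℕ.* ((a ℕ.+ b) ℕ.+ a)
        ℕ.+ ((3 ℕ.* (1 ℕ.+ j) ℕ.+ 1) ℕ.* (a ℕ.+ b) ℕ.+ (1 ℕ.+ j ℕ.+ 1) ℕ.* a)
        ℕ.+ ((3 ℕ.* j ℕ.+ 1) ℕ.* a ℕ.+ (j ℕ.+ 1) ℕ.* b)
  fib-identity = ℕ-Solver.solve-∀

ν-rec : ∀ j → 4 * ν (2 ℕ.+ j) ≡ 5 * μ (2 ℕ.+ j) + 2 * ν (1 ℕ.+ j) + ν j
ν-rec j = begin
  4 * (fromℕ (R (2 ℕ.+ j)) * (½ * (½ * P)))
    ≡⟨ cong (λ x → 4 * (fromℕ x * (½ * (½ * P)))) (R-rec j) ⟩
  4 * (fromℕ (5 ℕ.* F (3 ℕ.+ j) ℕ.+ R (1 ℕ.+ j) ℕ.+ R j) * (½ * (½ * P)))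
    ≡⟨ cong (λ x → 4 * (x * (½ * (½ * P)))) cast ⟩
  4 * ((5 * f + r₁ + r₀) * (½ * (½ * P)))
    ≡⟨ regroup f r₁ r₀ P ⟩
  5 * (f * P) + 2 * (r₁ * (½ * P)) + r₀ * P ∎
  where
  open ≡-Reasoning
  f r₁ r₀ P : ℚ
  f = fromℕ (F (3 ℕ.+ j))
  r₁ = fromℕ (R (1 ℕ.+ j))
  r₀ = fromℕ (R j)
  P = ½ ^ (4 ℕ.+ j)
  cast : fromℕ (5 ℕ.* F (3 ℕ.+ j) ℕ.+ R (1 ℕ.+ j) ℕ.+ R j) ≡ 5 * f + r₁ + r₀
  cast = trans (fromℕ-+ (5 ℕ.* F (3 ℕ.+ j) ℕ.+ R (1 ℕ.+ j)) (R j))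
               (cong (_+ r₀) (trans (fromℕ-+ (5 ℕ.* F (3 ℕ.+ j)) (R (1 ℕ.+ j)))
                                    (cong (_+ r₁) (fromℕ-* 5 (F (3 ℕ.+ j))))))
  regroup : ∀ f r₁ r₀ P →
    4 * ((5 * f + r₁ + r₀) * (½ * (½ * P))) ≡ 5 * (f * P) + 2 * (r₁ * (½ * P)) + r₀ * P
  regroup = solve-∀ ℚ-ring

-- Bounds on the tails

zero-tail : ∀ {c B} → (∀ n → c n ≡ 0ℚ) → 0ℚ ≤ B → ∀ K → 0ℚ - S₀ c K ∈[0, B ]
zero-tail c≡0 0≤B K rewrite S₀-zero c≡0 K = ℚₚ.≤-refl , 0≤B

tail₀-bound : ∀ m K → μ m - S₀ (C₂ m) K ∈[0, r ^ suc K ]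
tail₀-bound zero K =
  mean-bound (zeroth-moment-identity C₂-pascal₀ (μ 0) 0ℚ 0ℚ refl K)
             (lead-bound 0 (suc K)) (zero-tail (λ _ → refl) (^-nonNeg (suc K) 0≤r) K)
             (zero-tail (λ _ → refl) (^-nonNeg (suc K) 0≤r) K)
tail₀-bound (suc zero) K =
  mean-bound (zeroth-moment-identity C₂-pascal₁ (μ 1) (μ 0) 0ℚ refl K)
             (lead-bound 1 (suc K)) (tail₀-bound zero K) (zero-tail (λ _ → refl) (^-nonNeg (suc K) 0≤r) K)
tail₀-bound (suc (suc zero)) K =
  mean-bound (zeroth-moment-identity (C₂-pascal 0) (μ 2) (μ 1) (μ 0) refl K)
             (lead-bound 2 (suc K)) (tail₀-bound (suc zero) K) (tail₀-bound zero K)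
tail₀-bound (suc (suc (suc j))) K =
  mean-bound (zeroth-moment-identity (C₂-pascal (suc j)) (μ (3 ℕ.+ j)) (μ (2 ℕ.+ j)) (μ (1 ℕ.+ j)) (μ-rec j) K)
             (lead-bound (3 ℕ.+ j) (suc K)) (tail₀-bound (suc (suc j)) K) (tail₀-bound (suc j) K)

B₁ : ℕ → ℚ
B₁ K = fromℕ (suc K ℕ.+ 4) * r ^ suc K

0≤B₁ : ∀ K → 0ℚ ≤ B₁ K
0≤B₁ K = *-nonNeg (0≤fromℕ (suc K ℕ.+ 4)) (^-nonNeg (suc K) 0≤r)

lead₁-bound : ∀ m K →
  ⅕ ^ suc K * (fromℕ (suc K) * C₂ m (suc K)) + 5 * (μ m - S₀ (C₂ m) (suc K)) ∈[0, B₁ K ]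
lead₁-bound m K =
  subst₂ _∈[0,_] (cong (_+ 5 * (μ m - S₀ (C₂ m) (suc K))) (swap k (⅕ ^ suc K) (C₂ m (suc K)))) bound-sum
    (∈-+ (∈-* (0≤fromℕ (suc K)) (lead-bound m (suc K))) (∈-* (0≤fromℕ 5) (tail₀-bound m (suc K))))
  where
  k : ℚ
  k = fromℕ (suc K)
  swap : ∀ k x a → k * (x * a) ≡ x * (k * a)
  swap = solve-∀ ℚ-ring
  collect : ∀ k y → k * y + 5 * (r * y) ≡ (k + 4) * y
  collect = solve-∀ ℚ-ring
  bound-sum : k * r ^ suc K + 5 * r ^ suc (suc K) ≡ B₁ K
  bound-sum = trans (collect k (r ^ suc K)) (cong (_* r ^ suc K) (sym (fromℕ-+ (suc K) 4)))

tail₁-bound : ∀ m K → ν m - S₁ (C₂ m) K ∈[0, B₁ K ]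
tail₁-bound zero K =
  mean-bound (first-moment-identity C₂-pascal₀ (μ 0) (ν 0) 0ℚ 0ℚ refl K)
             (lead₁-bound 0 K) (zero-tail weight-zeros (0≤B₁ K) K) (zero-tail weight-zeros (0≤B₁ K) K)
tail₁-bound (suc zero) K =
  mean-bound (first-moment-identity C₂-pascal₁ (μ 1) (ν 1) (ν 0) 0ℚ refl K)
             (lead₁-bound 1 K) (tail₁-bound zero K) (zero-tail weight-zeros (0≤B₁ K) K)
tail₁-bound (suc (suc j)) K =
  mean-bound (first-moment-identity (C₂-pascal j) (μ (2 ℕ.+ j)) (ν (2 ℕ.+ j)) (ν (1 ℕ.+ j)) (ν j) (ν-rec j) K)
             (lead₁-bound (2 ℕ.+ j) K) (tail₁-bound (suc j) K) (tail₁-bound j K)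

r*fromℕ≤ : ∀ a b → 4 ℕ.* a ℕ.≤ 5 ℕ.* b → r * fromℕ a ≤ fromℕ b
r*fromℕ≤ a b 4a≤5b = ℚₚ.*-cancelˡ-≤-pos 5 (subst₂ _≤_ lhs (fromℕ-* 5 b) (fromℕ-mono-≤ 4a≤5b))
  where
  4≡5*r : ∀ x → 4 * x ≡ 5 * (r * x)
  4≡5*r = solve-∀ ℚ-ring
  lhs : fromℕ (4 ℕ.* a) ≡ 5 * (r * fromℕ a)
  lhs = trans (fromℕ-* 4 a) (4≡5*r (fromℕ a))

geometric-decay : ∀ (p : ℕ → ℕ) → (∀ K → 4 ℕ.* p (suc K) ℕ.≤ 5 ℕ.* p K) →
                  ∀ K → r ^ K * fromℕ (p K) ≤ fromℕ (p 0)
geometric-decay p decay zero    = ℚₚ.≤-reflexive (ℚₚ.*-identityˡ (fromℕ (p 0)))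
geometric-decay p decay (suc K) = begin
  r * r ^ K * fromℕ (p (suc K))    ≡⟨ ℚₚ.*-assoc r (r ^ K) (fromℕ (p (suc K))) ⟩
  r * (r ^ K * fromℕ (p (suc K)))  ≡⟨ swap r (r ^ K) (fromℕ (p (suc K))) ⟩
  r ^ K * (r * fromℕ (p (suc K)))  ≤⟨ *-monoˡ-≤ (^-nonNeg K 0≤r) (r*fromℕ≤ (p (suc K)) (p K) (decay K)) ⟩
  r ^ K * fromℕ (p K)              ≤⟨ geometric-decay p decay K ⟩
  fromℕ (p 0)                      ∎
  where
  open ℚₚ.≤-Reasoning
  swap : ∀ x y z → x * (y * z) ≡ y * (x * z)
  swap = solve-∀ ℚ-ring

first-moment-rate : ∀ K → B₁ K * fromℕ (suc K) ≤ 36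
first-moment-rate K = begin
  fromℕ (suc K ℕ.+ 4) * r ^ suc K * fromℕ (suc K)
    ≡⟨ regroup (fromℕ (suc K ℕ.+ 4)) (r ^ K) (fromℕ (suc K)) ⟩
  r ^ K * (r * (fromℕ (suc K ℕ.+ 4) * fromℕ (suc K)))
    ≡⟨ cong (λ x → r ^ K * (r * x)) (sym (fromℕ-* (suc K ℕ.+ 4) (suc K))) ⟩
  r ^ K * (r * fromℕ ((suc K ℕ.+ 4) ℕ.* suc K))
    ≤⟨ *-monoˡ-≤ (^-nonNeg K 0≤r) (r*fromℕ≤ ((suc K ℕ.+ 4) ℕ.* suc K) (p K) (dominated K)) ⟩
  r ^ K * fromℕ (p K)
    ≤⟨ geometric-decay p decay K ⟩
  36 ∎
  where
  open ℚₚ.≤-Reasoning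
  regroup : ∀ a y b → a * (r * y) * b ≡ y * (r * (a * b))
  regroup = solve-∀ ℚ-ring
  -- 4 p (K + 1) + K² = 5 p K, and p K dominates (5/4) (K + 1) (K + 5).
  p : ℕ → ℕ
  p K = K ℕ.* K ℕ.+ 8 ℕ.* K ℕ.+ 36
  decay-identity : ∀ K → 5 ℕ.* (K ℕ.* K ℕ.+ 8 ℕ.* K ℕ.+ 36)
                           ≡ 4 ℕ.* (suc K ℕ.* suc K ℕ.+ 8 ℕ.* suc K ℕ.+ 36) ℕ.+ K ℕ.* K
  decay-identity = ℕ-Solver.solve-∀
  decay : ∀ K → 4 ℕ.* p (suc K) ℕ.≤ 5 ℕ.* p K
  decay K = subst (4 ℕ.* p (suc K) ℕ.≤_) (sym (decay-identity K)) (ℕₚ.m≤m+n _ (K ℕ.* K))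
  dominated-identity : ∀ K → 5 ℕ.* (K ℕ.* K ℕ.+ 8 ℕ.* K ℕ.+ 36)
                               ≡ 4 ℕ.* ((suc K ℕ.+ 4) ℕ.* suc K) ℕ.+ (K ℕ.* K ℕ.+ 16 ℕ.* K ℕ.+ 160)
  dominated-identity = ℕ-Solver.solve-∀
  dominated : ∀ K → 4 ℕ.* ((suc K ℕ.+ 4) ℕ.* suc K) ℕ.≤ 5 ℕ.* p K
  dominated K = subst (4 ℕ.* ((suc K ℕ.+ 4) ℕ.* suc K) ℕ.≤_) (sym (dominated-identity K)) (ℕₚ.m≤m+n _ _)

-- Convergence

record ApproachesFromBelow (s : ℕ → ℚ) (L : ℚ) (a : ℕ) : Set where
  field
    gap-nonNeg : ∀ K → 0ℚ ≤ L - s K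
    gap-rate   : ∀ K → (L - s K) * fromℕ (suc K) ≤ fromℕ a

open ApproachesFromBelow

approaches-cong : ∀ {s t L M a} → (∀ K → s K ≡ t K) → L ≡ M →
                  ApproachesFromBelow s L a → ApproachesFromBelow t M a
approaches-cong {s} {t} {L} s≡t refl approaches = record
  { gap-nonNeg = λ K → subst (λ x → 0ℚ ≤ L - x) (s≡t K) (gap-nonNeg approaches K)
  ; gap-rate   = λ K → subst (λ x → (L - x) * fromℕ (suc K) ≤ _) (s≡t K) (gap-rate approaches K)
  }

approaches-+ : ∀ {s t L M a b} → ApproachesFromBelow s L a → ApproachesFromBelow t M b →
               ApproachesFromBelow (λ K → s K + t K) (L + M) (a ℕ.+ b)
approaches-+ {s} {t} {L} {M} {a} {b} approaches-s approaches-t = record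
  { gap-nonNeg = λ K → subst (0ℚ ≤_) (sym (gap K))
                              (ℚₚ.+-mono-≤ (gap-nonNeg approaches-s K) (gap-nonNeg approaches-t K))
  ; gap-rate   = rate
  }
  where
  split-gap : ∀ L M s t → L + M - (s + t) ≡ (L - s) + (M - t)
  split-gap = solve-∀ ℚ-ring
  gap : ∀ K → L + M - (s K + t K) ≡ (L - s K) + (M - t K)
  gap K = split-gap L M (s K) (t K)
  rate : ∀ K → (L + M - (s K + t K)) * fromℕ (suc K) ≤ fromℕ (a ℕ.+ b)
  rate K = begin
    (L + M - (s K + t K)) * k                ≡⟨ cong (_* k) (gap K) ⟩
    ((L - s K) + (M - t K)) * k              ≡⟨ ℚₚ.*-distribʳ-+ k (L - s K) (M - t K) ⟩
    (L - s K) * k + (M - t K) * k            ≤⟨ ℚₚ.+-mono-≤ (gap-rate approaches-s K) (gap-rate approaches-t K) ⟩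
    fromℕ a + fromℕ b                        ≡⟨ sym (fromℕ-+ a b) ⟩
    fromℕ (a ℕ.+ b)                          ∎
    where
    open ℚₚ.≤-Reasoning
    k : ℚ
    k = fromℕ (suc K)

eventually-fromℕ< : ∀ a ε → 0ℚ < ε → ∃[ N ] (∀ K → N ℕ.≤ K → fromℕ a < ε * fromℕ K)
eventually-fromℕ< a (mkℚ (+ zero) d _)   (*<* (ℤ.+<+ ()))
eventually-fromℕ< a (mkℚ -[1+ n ] d _)   (*<* ())
eventually-fromℕ< a ε@(mkℚ (+ suc p) d _) _ = suc (a ℕ.* suc d) , λ K N≤K →
  ℚₚ.*-cancelʳ-<-nonNeg (fromℕ (suc d)) {{ℚ.nonNegative (0≤fromℕ (suc d))}} (begin-strict
    fromℕ a * fromℕ (suc d)       ≡⟨ sym (fromℕ-* a (suc d)) ⟩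
    fromℕ (a ℕ.* suc d)           <⟨ fromℕ-mono-< (ℕₚ.<-≤-trans N≤K (ℕₚ.m≤n*m K (suc p))) ⟩
    fromℕ (suc p ℕ.* K)           ≡⟨ fromℕ-* (suc p) K ⟩
    fromℕ (suc p) * fromℕ K       ≡⟨ cong (_* fromℕ K) (sym ε*denominator) ⟩
    ε * fromℕ (suc d) * fromℕ K   ≡⟨ swap ε (fromℕ (suc d)) (fromℕ K) ⟩
    ε * fromℕ K * fromℕ (suc d)   ∎)
  where
  open ℚₚ.≤-Reasoning
  swap : ∀ x y z → x * y * z ≡ x * z * y
  swap = solve-∀ ℚ-ring
  ε*denominator : ε * fromℕ (suc d) ≡ fromℕ (suc p)
  ε*denominator = trans (ℚₚ.fromℚᵘ-cong {ℚᵘ.mkℚᵘ (+ suc p ℤ.* + suc d) (d ℕ.* 1)} {ℚᵘ.mkℚᵘ (+ suc p) 0}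
                                          (ℚᵘ.*≡* cross))
                        (ℚₚ.↥p/↧p≡p (fromℕ (suc p)))
    where
    cross : (+ suc p ℤ.* + suc d) ℤ.* + 1 ≡ + suc p ℤ.* + suc (d ℕ.* 1)
    cross = trans (ℤₚ.*-identityʳ _) (cong (λ x → + suc p ℤ.* + suc x) (sym (ℕₚ.*-identityʳ d)))

approaches⇒convergesTo : ∀ {s L a} → ApproachesFromBelow s L a → ConvergesTo s L
approaches⇒convergesTo {s} {L} {a} approaches ε 0<ε with eventually-fromℕ< a ε 0<ε
... | N , a<ε*K = N , λ K N≤K → begin-strict
  ∣ s K - L ∣      ≡⟨ cong ∣_∣ (flip (s K) L) ⟩
  ∣ - (L - s K) ∣  ≡⟨ ℚₚ.∣-p∣≡∣p∣ (L - s K) ⟩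
  ∣ L - s K ∣      ≡⟨ ℚₚ.0≤p⇒∣p∣≡p (gap-nonNeg approaches K) ⟩
  L - s K          <⟨ ℚₚ.*-cancelʳ-<-nonNeg (fromℕ (suc K)) {{ℚ.nonNegative (0≤fromℕ (suc K))}}
                        (ℚₚ.≤-<-trans (gap-rate approaches K) (a<ε*K (suc K) (ℕₚ.m≤n⇒m≤1+n N≤K))) ⟩
  ε                ∎
  where
  open ℚₚ.≤-Reasoning
  flip : ∀ a b → a - b ≡ - (b - a)
  flip = solve-∀ ℚ-ring

over5^-≡ : ∀ k e → k over5^ e ≡ fromℕ k * ⅕ ^ e
over5^-≡ k e = /-^ (+ k) 4 e

S-even-≡ : ∀ m K → S-even m K ≡ S₁ (C₂ m) K
S-even-≡ m = Σ₁-cong term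
  where
  term : ∀ n → (n ℕ.* ((2 ℕ.* n) C m)) over5^ (n ℕ.+ 1) ≡ fromℕ n * C₂ m n * ⅕ ^ suc n
  term n = trans (over5^-≡ (n ℕ.* ((2 ℕ.* n) C m)) (n ℕ.+ 1))
                 (cong₂ _*_ (fromℕ-* n ((2 ℕ.* n) C m)) (cong (⅕ ^_) (ℕₚ.+-comm n 1)))

C-odd : ∀ N m → (N ℕ.+ 1) C suc m ≡ N C suc m ℕ.+ N C m
C-odd N m = trans (cong (_C suc m) (ℕₚ.+-comm N 1))
                  (trans (sym (nCk+nC[k+1]≡[n+1]C[k+1] N m)) (ℕₚ.+-comm (N C m) (N C suc m)))

S-odd-≡ : ∀ m K → S-odd (suc m) K ≡ S₁ (C₂ (suc m)) K + S₁ (C₂ m) K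
S-odd-≡ m K = trans (Σ₁-cong term K) (Σ₁-+ _ _ K)
  where
  distribute : ∀ k a b y → k * (a + b) * y ≡ k * a * y + k * b * y
  distribute = solve-∀ ℚ-ring
  term : ∀ n → (n ℕ.* ((2 ℕ.* n ℕ.+ 1) C suc m)) over5^ (n ℕ.+ 1)
               ≡ fromℕ n * C₂ (suc m) n * ⅕ ^ suc n + fromℕ n * C₂ m n * ⅕ ^ suc n
  term n = begin
    (n ℕ.* ((2 ℕ.* n ℕ.+ 1) C suc m)) over5^ (n ℕ.+ 1)
      ≡⟨ over5^-≡ (n ℕ.* ((2 ℕ.* n ℕ.+ 1) C suc m)) (n ℕ.+ 1) ⟩
    fromℕ (n ℕ.* ((2 ℕ.* n ℕ.+ 1) C suc m)) * ⅕ ^ (n ℕ.+ 1)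
      ≡⟨ cong₂ _*_ (cong (λ x → fromℕ (n ℕ.* x)) (C-odd (2 ℕ.* n) m)) (cong (⅕ ^_) (ℕₚ.+-comm n 1)) ⟩
    fromℕ (n ℕ.* ((2 ℕ.* n) C suc m ℕ.+ (2 ℕ.* n) C m)) * ⅕ ^ suc n
      ≡⟨ cong (_* ⅕ ^ suc n) (fromℕ-* n ((2 ℕ.* n) C suc m ℕ.+ (2 ℕ.* n) C m)) ⟩
    fromℕ n * fromℕ ((2 ℕ.* n) C suc m ℕ.+ (2 ℕ.* n) C m) * ⅕ ^ suc n
      ≡⟨ cong (λ x → fromℕ n * x * ⅕ ^ suc n) (fromℕ-+ ((2 ℕ.* n) C suc m) ((2 ℕ.* n) C m)) ⟩
    fromℕ n * (C₂ (suc m) n + C₂ m n) * ⅕ ^ suc n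
      ≡⟨ distribute (fromℕ n) (C₂ (suc m) n) (C₂ m n) (⅕ ^ suc n) ⟩
    fromℕ n * C₂ (suc m) n * ⅕ ^ suc n + fromℕ n * C₂ m n * ⅕ ^ suc n ∎
    where open ≡-Reasoning

RHS-even-≡ : ∀ m → RHS-even m ≡ ν m
RHS-even-≡ m = trans (/-^ (+ R m) 1 (m ℕ.+ 4)) (cong (λ e → fromℕ (R m) * ½ ^ e) (ℕₚ.+-comm m 4))

odd-numerator : ∀ m →
  + (5 ℕ.* suc m ℕ.+ 1) ℤ.* + F (suc (suc m)) ℤ.+ (+ (5 ℕ.* suc m) ℤ.- + 3) ℤ.* + F (suc m)
    ≡ + (R (suc m) ℕ.+ 2 ℕ.* R m)
odd-numerator m = begin
  + a ℤ.* + (f₁ ℕ.+ f₀) ℤ.+ (+ (5 ℕ.* suc m) ℤ.- + 3) ℤ.* + f₁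
    ≡⟨ cong (λ x → + a ℤ.* + (f₁ ℕ.+ f₀) ℤ.+ (+ x ℤ.- + 3) ℤ.* + f₁) (ℕₚ.*-suc 5 m) ⟩
  + a ℤ.* + (f₁ ℕ.+ f₀) ℤ.+ + b ℤ.* + f₁
    ≡⟨ sym (trans (ℤₚ.pos-+ (a ℕ.* (f₁ ℕ.+ f₀)) (b ℕ.* f₁))
                  (cong₂ ℤ._+_ (ℤₚ.pos-* a (f₁ ℕ.+ f₀)) (ℤₚ.pos-* b f₁))) ⟩
  + (a ℕ.* (f₁ ℕ.+ f₀) ℕ.+ b ℕ.* f₁)
    ≡⟨ cong +_ (fib-identity m f₁ f₀) ⟩
  + (R (suc m) ℕ.+ 2 ℕ.* R m) ∎
  where
  open ≡-Reasoning
  a b f₁ f₀ : ℕ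
  a = 5 ℕ.* suc m ℕ.+ 1
  b = 2 ℕ.+ 5 ℕ.* m
  f₁ = F (suc m)
  f₀ = F m
  fib-identity : ∀ m f₁ f₀ →
    (5 ℕ.* suc m ℕ.+ 1) ℕ.* (f₁ ℕ.+ f₀) ℕ.+ (2 ℕ.+ 5 ℕ.* m) ℕ.* f₁
      ≡ (3 ℕ.* suc m ℕ.+ 1) ℕ.* (f₁ ℕ.+ f₀) ℕ.+ (suc m ℕ.+ 1) ℕ.* f₁
        ℕ.+ 2 ℕ.* ((3 ℕ.* m ℕ.+ 1) ℕ.* f₁ ℕ.+ (m ℕ.+ 1) ℕ.* f₀)
  fib-identity = ℕ-Solver.solve-∀

RHS-odd-≡ : ∀ m → RHS-odd (suc m) ≡ ν (suc m) + ν m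
RHS-odd-≡ m = begin
  RHS-odd (suc m)
    ≡⟨ ℚₚ./-cong {{nz}} {{nz}} (odd-numerator m) refl ⟩
  (+ (R (suc m) ℕ.+ 2 ℕ.* R m) / 2 ℕ.^ (suc m ℕ.+ 4)) {{nz}}
    ≡⟨ /-^ (+ (R (suc m) ℕ.+ 2 ℕ.* R m)) 1 (suc m ℕ.+ 4) ⟩
  fromℕ (R (suc m) ℕ.+ 2 ℕ.* R m) * ½ ^ (suc m ℕ.+ 4)
    ≡⟨ cong₂ _*_ (trans (fromℕ-+ (R (suc m)) (2 ℕ.* R m)) (cong (_+_ r₁) (fromℕ-* 2 (R m))))
                 (cong (½ ^_) (ℕₚ.+-comm (suc m) 4)) ⟩
  (r₁ + 2 * r₀) * (½ * P)
    ≡⟨ distribute r₁ r₀ P ⟩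
  r₁ * (½ * P) + r₀ * P ∎
  where
  open ≡-Reasoning
  nz : ℕ.NonZero (2 ℕ.^ (suc m ℕ.+ 4))
  nz = ℕₚ.m^n≢0 2 (suc m ℕ.+ 4)
  r₁ r₀ P : ℚ
  r₁ = fromℕ (R (suc m))
  r₀ = fromℕ (R m)
  P = ½ ^ (4 ℕ.+ m)
  distribute : ∀ r₁ r₀ P → (r₁ + 2 * r₀) * (½ * P) ≡ r₁ * (½ * P) + r₀ * P
  distribute = solve-∀ ℚ-ring

first-moment-approaches : ∀ m → ApproachesFromBelow (S₁ (C₂ m)) (ν m) 36
first-moment-approaches m = record
  { gap-nonNeg = λ K → proj₁ (tail₁-bound m K)
  ; gap-rate   = λ K → ℚₚ.≤-trans (ℚₚ.*-monoʳ-≤-nonNeg (fromℕ (suc K)) {{ℚ.nonNegative (0≤fromℕ (suc K))}}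
                                                     (proj₂ (tail₁-bound m K)))
                                  (first-moment-rate K)
  }

even-approaches : ∀ m → ApproachesFromBelow (S-even m) (RHS-even m) 36
even-approaches m = approaches-cong (λ K → sym (S-even-≡ m K)) (sym (RHS-even-≡ m)) (first-moment-approaches m)

odd-approaches : ∀ m → ApproachesFromBelow (S-odd (suc m)) (RHS-odd (suc m)) 72
odd-approaches m = approaches-cong (λ K → sym (S-odd-≡ m K)) (sym (RHS-odd-≡ m))
                     (approaches-+ (first-moment-approaches (suc m)) (first-moment-approaches m))

-- For m = 0 the two statements coincide, as C(2n+1,0) = C(2n,0) = 1.
theorem5 : ∀ (m : ℕ) →
    ConvergesTo (S-odd m) (RHS-odd m) × ConvergesTo (S-even m) (RHS-even m)
theorem5 zero    = approaches⇒convergesTo (even-approaches 0) , approaches⇒convergesTo (even-approaches 0)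
theorem5 (suc m) = approaches⇒convergesTo (odd-approaches m) , approaches⇒convergesTo (even-approaches (suc m))
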